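{- For integers $k,n,m\geq 1$, let $s_{k,n,m}$ be the number of parallelogram polycubes of width $k$, height $n$ and depth $m$. Then $$s_{k,n,m}=\frac{nm}{k^2(n+k-1)(m+k-1)}\binom{n+k-1}{k-1}^2\binom{m+k-1}{k-1}^2.$$
   Context: A polycube is a finite set of unit cubes of $\mathbb{Z}^3$ (coordinates $(i,j,k)$), considered up to translation. A plateau is a set of cubes with a single common $i$-coordinate forming a full rectangle $\{(i,j,k): b\le j\le t,\ f\le k\le r\}$ (bottom $b$, top $t$, front $f$, back $r$). A parallelogram polycube of width $k$ is a union of $k$ plateaus $P_1,\dots,P_k$ at consecutive $i$-coordinates $1,\dots,k$ with bottoms $b_\ell$, tops $t_\ell$, fronts $f_\ell$, backs $r_\ell$, such that each of these four sequences is weakly increasing and $b_{\ell+1}\le t_\ell$, $f_{\ell+1}\le r_\ell$ for $1\le\ell\le k-1$. Its width is the number $k$ of plateaus, its height is the number of distinct $j$-coordinates of its cubes (i.e. $t_k-b_1+1$), and its depth is the number of distinct $k$-coordinates of its cubes (i.e. $r_k-f_1+1$). -}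

module Defs where

open import Data.Nat using (ℕ; zero; suc; _+_; _∸_; _≤ᵇ_; _≡ᵇ_)
open import Data.Bool using (Bool; true; false; _∧_)
open import Data.List using (List; []; _∷_; map; concatMap; filter; length; upTo)
open import Data.Product using (_×_; _,_)
open import Relation.Nullary.Decidable using (Dec)
open import Data.Bool.Properties using (T?)
open import Data.Bool using (T)

-- A plateau at a given i-coordinate, recorded as (bottom , top , front , back):
-- the full rectangle { (i,j,k) : b ≤ j ≤ t , f ≤ k ≤ r }.
record Plateau : Set where
  constructor plateau
  field
    bot top front back : ℕ
open Plateau public

plateauOK : Plateau → Bool
plateauOK p = (bot p ≤ᵇ top p) ∧ (front p ≤ᵇ back p)

stepOK : Plateau → Plateau → Bool
stepOK p q =
  (bot p ≤ᵇ bot q) ∧ (top p ≤ᵇ top q) ∧ (front p ≤ᵇ front q) ∧ (back p ≤ᵇ back q)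
  ∧ (bot q ≤ᵇ top p) ∧ (front q ≤ᵇ back p)

allPlateausOK : List Plateau → Bool
allPlateausOK []       = true
allPlateausOK (p ∷ ps) = plateauOK p ∧ allPlateausOK ps

chainOK : List Plateau → Bool
chainOK []           = true
chainOK (p ∷ [])     = true
chainOK (p ∷ q ∷ ps) = stepOK p q ∧ chainOK (q ∷ ps)

-- Normalisation modulo translation: plateaus sit at i = 1..k (list order),
-- the first plateau has bottom 0 and front 0.
firstNormalised : List Plateau → Bool
firstNormalised []      = false
firstNormalised (p ∷ _) = (bot p ≡ᵇ 0) ∧ (front p ≡ᵇ 0)

-- height = t_k - b_1 + 1 = n and depth = r_k - f_1 + 1 = m (with b_1 = f_1 = 0)
lastHasSize : ℕ → ℕ → List Plateau → Bool
lastHasSize n m []           = false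
lastHasSize n m (p ∷ [])     = ((top p + 1) ≡ᵇ n) ∧ ((back p + 1) ≡ᵇ m)
lastHasSize n m (p ∷ q ∷ ps) = lastHasSize n m (q ∷ ps)

isParallelogram : ℕ → ℕ → List Plateau → Bool
isParallelogram n m ps =
  allPlateausOK ps ∧ chainOK ps ∧ firstNormalised ps ∧ lastHasSize n m ps

listsOfLength : {A : Set} → ℕ → List A → List (List A)
listsOfLength zero    xs = [] ∷ []
listsOfLength (suc k) xs = concatMap (λ x → map (x ∷_) (listsOfLength k xs)) xs

candidatePlateaus : ℕ → ℕ → List Plateau
candidatePlateaus n m =
  concatMap (λ b → concatMap (λ t → concatMap (λ f → map (λ r → plateau b t f r)
    (upTo m)) (upTo m)) (upTo n)) (upTo n)

-- Every normalised one has all coordinates in the ranges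
-- above, so this enumeration is exhaustive; distinct plateau sequences give
-- distinct cube sets.
s : ℕ → ℕ → ℕ → ℕ
s k n m = length (filter (λ ps → T? (isParallelogram n m ps))
                         (listsOfLength k (candidatePlateaus n m)))

-- The conditions on a parallelogram polycube constrain the (bottom, top) intervals and the
-- (front, back) intervals of its plateaus independently, so s k n m is the product of the
-- numbers of parallelogram polyominoes of width k and heights n and m.  Building a polyomino
-- interval by interval, first raising the bottom and then the top, gives a pair of
-- recurrences solved by 2 × 2 determinants of binomial coefficients, as the two boundaries
-- are non-crossing lattice paths (Lindström–Gessel–Viennot).  The number of polyominoes of
-- width k and height n comes out as the Narayana number n / (k (n + k - 1)) · C(n + k - 1, k - 1)².
module Submission where

open import Defs

module Pascal where

  open import Data.Nat using (ℕ; zero; suc; _+_; _*_; _!)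
  open import Data.Nat.Combinatorics using (_C_; nCk+nC[k+1]≡[n+1]C[k+1]; nCn≡1)
  open import Data.Nat.Properties
  open import Data.Nat.Tactic.RingSolver using (solve-∀)
  open import Relation.Binary.PropositionalEquality

  pascal : ℕ → ℕ → ℕ
  pascal zero    q       = 1
  pascal (suc p) zero    = 1
  pascal (suc p) (suc q) = pascal p (suc q) + pascal (suc p) q

  C≡pascal : ∀ p q → (p + q) C p ≡ pascal p q
  C≡pascal zero    q       = refl
  C≡pascal (suc p) zero    = trans (cong (_C suc p) (+-identityʳ (suc p))) (nCn≡1 (suc p))
  C≡pascal (suc p) (suc q) = begin
    suc (p + suc q) C suc p                  ≡⟨ nCk+nC[k+1]≡[n+1]C[k+1] (p + suc q) p ⟨
    (p + suc q) C p + (p + suc q) C suc p    ≡⟨ cong ((p + suc q) C p +_) (cong (_C suc p) (+-suc p q)) ⟩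
    (p + suc q) C p + (suc p + q) C suc p    ≡⟨ cong₂ _+_ (C≡pascal p (suc q)) (C≡pascal (suc p) q) ⟩
    pascal p (suc q) + pascal (suc p) q      ∎
    where open ≡-Reasoning

  pascal-sym : ∀ p q → pascal p q ≡ pascal q p
  pascal-sym zero    zero    = refl
  pascal-sym zero    (suc q) = refl
  pascal-sym (suc p) zero    = refl
  pascal-sym (suc p) (suc q) =
    trans (cong₂ _+_ (pascal-sym p (suc q)) (pascal-sym (suc p) q))
          (+-comm (pascal (suc q) p) (pascal q (suc p)))

  pascal-zeroʳ : ∀ p → pascal p 0 ≡ 1
  pascal-zeroʳ zero    = refl
  pascal-zeroʳ (suc p) = refl

  pascal-oneʳ : ∀ p → pascal p 1 ≡ suc p
  pascal-oneʳ zero    = refl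
  pascal-oneʳ (suc p) = trans (cong (_+ 1) (pascal-oneʳ p)) (+-comm (suc p) 1)

  pascal-factorial : ∀ p q → pascal p q * (p ! * q !) ≡ (p + q) !
  pascal-factorial zero    q       = trans (*-identityˡ _) (*-identityˡ _)
  pascal-factorial (suc p) zero    =
    trans (*-identityˡ _) (trans (*-identityʳ _) (cong _! (sym (+-identityʳ (suc p)))))
  pascal-factorial (suc p) (suc q) = begin
    (pascal p (suc q) + pascal (suc p) q) * (suc p ! * suc q !)
      ≡⟨ distribute (pascal p (suc q)) (pascal (suc p) q) p q (p !) (q !) ⟩
    suc p * (pascal p (suc q) * (p ! * suc q !)) + suc q * (pascal (suc p) q * (suc p ! * q !))
      ≡⟨ cong₂ (λ x y → suc p * x + suc q * y) (pascal-factorial p (suc q)) (pascal-factorial (suc p) q) ⟩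
    suc p * (p + suc q) ! + suc q * (suc p + q) !
      ≡⟨ cong (λ z → suc p * z ! + suc q * (suc p + q) !) (+-suc p q) ⟩
    suc p * (suc p + q) ! + suc q * (suc p + q) !
      ≡⟨ *-distribʳ-+ ((suc p + q) !) (suc p) (suc q) ⟨
    (suc p + suc q) * (suc p + q) !
      ≡⟨ cong (_* (suc p + q) !) (+-suc (suc p) q) ⟩
    suc (suc p + q) !
      ≡⟨ cong _! (+-suc (suc p) q) ⟨
    (suc p + suc q) !
      ∎
    where
    open ≡-Reasoning
    distribute : ∀ a b p q p! q! → (a + b) * ((suc p * p!) * (suc q * q!))
               ≡ suc p * (a * (p! * (suc q * q!))) + suc q * (b * ((suc p * p!) * q!))
    distribute = solve-∀

  pascal-sucʳ-factorial : ∀ p q → pascal p (suc q) * suc q * (p ! * q !) ≡ suc (p + q) !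
  pascal-sucʳ-factorial p q = begin
    pascal p (suc q) * suc q * (p ! * q !)   ≡⟨ shuffle (pascal p (suc q)) q (p !) (q !) ⟩
    pascal p (suc q) * (p ! * suc q !)       ≡⟨ pascal-factorial p (suc q) ⟩
    (p + suc q) !                            ≡⟨ cong _! (+-suc p q) ⟩
    suc (p + q) !                            ∎
    where
    open ≡-Reasoning
    shuffle : ∀ a q p! q! → a * suc q * (p! * q!) ≡ a * (p! * (suc q * q!))
    shuffle = solve-∀

  pascal-sucˡ-factorial : ∀ p q → pascal (suc p) q * suc p * (p ! * q !) ≡ suc (p + q) !
  pascal-sucˡ-factorial p q = begin
    pascal (suc p) q * suc p * (p ! * q !)   ≡⟨ shuffle (pascal (suc p) q) p (p !) (q !) ⟩
    pascal (suc p) q * (suc p ! * q !)       ≡⟨ pascal-factorial (suc p) q ⟩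
    suc (p + q) !                            ∎
    where
    open ≡-Reasoning
    shuffle : ∀ a p p! q! → a * suc p * (p! * q!) ≡ a * ((suc p * p!) * q!)
    shuffle = solve-∀

  cancel-factorials : ∀ p q {x y} → x * (p ! * q !) ≡ y * (p ! * q !) → x ≡ y
  cancel-factorials p q = *-cancelʳ-≡ _ _ (p ! * q !) {{p !* q !≢0}}

  pascal-swap : ∀ p q → pascal p (suc q) * suc q ≡ pascal (suc p) q * suc p
  pascal-swap p q =
    cancel-factorials p q (trans (pascal-sucʳ-factorial p q) (sym (pascal-sucˡ-factorial p q)))

  pascal-absorb : ∀ p q → pascal p (suc q) * suc q ≡ suc (p + q) * pascal p q
  pascal-absorb p q = cancel-factorials p q (begin
    pascal p (suc q) * suc q * (p ! * q !)     ≡⟨ pascal-sucʳ-factorial p q ⟩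
    suc (p + q) * (p + q) !                    ≡⟨ cong (suc (p + q) *_) (pascal-factorial p q) ⟨
    suc (p + q) * (pascal p q * (p ! * q !))   ≡⟨ *-assoc (suc (p + q)) (pascal p q) _ ⟨
    suc (p + q) * pascal p q * (p ! * q !)     ∎)
    where open ≡-Reasoning

  -- pascal₋ p q is pascal (p - 1) q, taken to be 0 (not pascal 0 q) when p = 0.
  pascal₋ : ℕ → ℕ → ℕ
  pascal₋ zero    q = 0
  pascal₋ (suc p) q = pascal p q

  pascal₋-oneʳ : ∀ v → pascal₋ v 1 ≡ v
  pascal₋-oneʳ zero    = refl
  pascal₋-oneʳ (suc v) = pascal-oneʳ v

  pascal-sucˡ₋ : ∀ v q → pascal v (suc q) ≡ pascal v q + pascal₋ v (suc q)
  pascal-sucˡ₋ zero    q = refl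
  pascal-sucˡ₋ (suc v) q = +-comm (pascal v (suc q)) (pascal (suc v) q)

  pascal₋-swap : ∀ v q → pascal₋ v (suc q) * suc q ≡ pascal v q * v
  pascal₋-swap zero    q = sym (*-zeroʳ (pascal 0 q))
  pascal₋-swap (suc v) q = pascal-swap v q

module Completions where

  open import Data.Nat using (ℕ; zero; suc; _+_)
  open import Relation.Binary.PropositionalEquality

  -- fromColumn j u v is the number of ways to follow an interval of u + 1 rows, whose top
  -- lies v rows below the top row, by j intervals (bottoms and tops weakly increasing, each
  -- bottom at most the previous top) the last of which ends on the top row.  fromBottom j u v
  -- is the number of ways to finish once the next interval has its bottom u + 1 rows below
  -- the previous top: choose its top, then j more intervals.
  mutual
    fromColumn : ℕ → ℕ → ℕ → ℕ
    fromColumn zero    u zero    = 1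
    fromColumn zero    u (suc v) = 0
    fromColumn (suc j) zero    v = fromBottom j zero v
    fromColumn (suc j) (suc u) v = fromBottom j (suc u) v + fromColumn (suc j) u v

    fromBottom : ℕ → ℕ → ℕ → ℕ
    fromBottom j u zero    = fromColumn j u zero
    fromBottom j u (suc v) = fromColumn j u (suc v) + fromBottom j (suc u) v

  fromBottom-zero : ∀ u v → fromBottom 0 u v ≡ 1
  fromBottom-zero u zero    = refl
  fromBottom-zero u (suc v) = fromBottom-zero (suc u) v

  fromColumn-one : ∀ u v → fromColumn 1 u v ≡ suc u
  fromColumn-one zero    v = fromBottom-zero zero v
  fromColumn-one (suc u) v = cong₂ _+_ (fromBottom-zero (suc u) v) (fromColumn-one u v)

module Determinants where

  import Data.Nat as ℕ
  open import Data.Nat using (ℕ; zero; suc)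
  open import Data.Integer using (ℤ; +_; _+_; _-_; _*_)
  open import Data.Integer.Tactic.RingSolver using (solve-∀)
  import Data.Nat.Properties as ℕ
  import Data.Integer.Properties as ℤ
  open import Relation.Binary.PropositionalEquality
  open Pascal
  open Completions

  columnDet : ℕ → ℕ → ℕ → ℤ
  columnDet i s v = + pascal s (suc i) * + pascal v i - + pascal (suc s) i * + pascal₋ v (suc i)

  bottomDet : ℕ → ℕ → ℕ → ℤ
  bottomDet i s v =
    + pascal v (suc i) * + pascal s (suc i) - + pascal₋ v (suc (suc i)) * + pascal (suc s) i

  fromColumn-one-det : ∀ u v → + fromColumn 1 u v ≡ columnDet 0 (u ℕ.+ v) v
  fromColumn-one-det u v = sym (begin
    + pascal (u ℕ.+ v) 1 * + pascal v 0 - + pascal (suc (u ℕ.+ v)) 0 * + pascal₋ v 1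
      ≡⟨ cong₂ (λ a b → + a * + b - + 1 * + pascal₋ v 1) (pascal-oneʳ (u ℕ.+ v)) (pascal-zeroʳ v) ⟩
    (+ suc u + + v) * + 1 - + 1 * + pascal₋ v 1
      ≡⟨ cong (λ a → (+ suc u + + v) * + 1 - + 1 * + a) (pascal₋-oneʳ v) ⟩
    (+ suc u + + v) * + 1 - + 1 * + v
      ≡⟨ cancel (+ suc u) (+ v) ⟩
    + suc u
      ≡⟨ cong +_ (fromColumn-one u v) ⟨
    + fromColumn 1 u v
      ∎)
    where
    open ≡-Reasoning
    cancel : ∀ x y → (x + y) * + 1 - + 1 * y ≡ x
    cancel = solve-∀

  bottomDet-suc : ∀ i s v →
    bottomDet i (suc s) (suc v) ≡ columnDet i (suc s) (suc v) + bottomDet i (suc s) v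
  bottomDet-suc i s v =
    trans (cong (λ z → (a + b) * X - z * Y) (cong +_ (pascal-sucˡ₋ v (suc i)))) (expand a b c X Y)
    where
    a = + pascal v (suc i)
    b = + pascal (suc v) i
    c = + pascal₋ v (suc (suc i))
    X = + pascal (suc s) (suc i)
    Y = + pascal (suc (suc s)) i
    expand : ∀ a b c X Y → (a + b) * X - (a + c) * Y ≡ (X * b - Y * a) + (a * X - c * Y)
    expand = solve-∀

  columnDet-suc : ∀ i s v →
    columnDet (suc i) (suc s) v ≡ columnDet (suc i) s v + bottomDet i (suc s) v
  columnDet-suc i s v = expand (+ pascal s (suc (suc i))) X Y a c
    where
    a = + pascal v (suc i)
    c = + pascal₋ v (suc (suc i))
    X = + pascal (suc s) (suc i)
    Y = + pascal (suc (suc s)) i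
    expand : ∀ z X Y a c → (z + X) * a - (X + Y) * c ≡ (z * a - X * c) + (a * X - c * Y)
    expand = solve-∀

  columnDet-diagonal : ∀ i v → columnDet (suc i) v v ≡ bottomDet i v v
  columnDet-diagonal i v =
    trans (cong (λ z → z * a - (a + b) * c) (cong +_ (pascal-sucˡ₋ v (suc i)))) (expand a b c)
    where
    a = + pascal v (suc i)
    b = + pascal (suc v) i
    c = + pascal₋ v (suc (suc i))
    expand : ∀ a b c → (a + c) * a - (a + b) * c ≡ a * a - c * b
    expand = solve-∀

  columnDet≡bottomDet-zero : ∀ i s → columnDet i s 0 ≡ bottomDet i s 0
  columnDet≡bottomDet-zero i s = swap (+ pascal s (suc i)) (+ pascal (suc s) i)
    where
    swap : ∀ x y → x * + 1 - y * + 0 ≡ + 1 * x - + 0 * y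
    swap = solve-∀

  mutual
    fromColumn-det : ∀ i u v → + fromColumn (suc i) u v ≡ columnDet i (u ℕ.+ v) v
    fromColumn-det zero    u       v = fromColumn-one-det u v
    fromColumn-det (suc i) zero    v = trans (fromBottom-det i zero v) (sym (columnDet-diagonal i v))
    fromColumn-det (suc i) (suc u) v = begin
      + fromBottom (suc i) (suc u) v + + fromColumn (suc (suc i)) u v
        ≡⟨ cong₂ _+_ (fromBottom-det i (suc u) v) (fromColumn-det (suc i) u v) ⟩
      bottomDet i (suc (u ℕ.+ v)) v + columnDet (suc i) (u ℕ.+ v) v
        ≡⟨ ℤ.+-comm (bottomDet i (suc (u ℕ.+ v)) v) (columnDet (suc i) (u ℕ.+ v) v) ⟩
      columnDet (suc i) (u ℕ.+ v) v + bottomDet i (suc (u ℕ.+ v)) v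
        ≡⟨ columnDet-suc i (u ℕ.+ v) v ⟨
      columnDet (suc i) (suc (u ℕ.+ v)) v
        ∎
      where open ≡-Reasoning

    fromBottom-det : ∀ i u v → + fromBottom (suc i) u v ≡ bottomDet i (u ℕ.+ v) v
    fromBottom-det i u zero    = trans (fromColumn-det i u zero) (columnDet≡bottomDet-zero i (u ℕ.+ 0))
    fromBottom-det i u (suc v) = begin
      + fromColumn (suc i) u (suc v) + + fromBottom (suc i) (suc u) v
        ≡⟨ cong₂ _+_ (fromColumn-det i u (suc v)) (fromBottom-det i (suc u) v) ⟩
      columnDet i (u ℕ.+ suc v) (suc v) + bottomDet i (suc (u ℕ.+ v)) v
        ≡⟨ cong (λ s → columnDet i s (suc v) + bottomDet i (suc (u ℕ.+ v)) v) (ℕ.+-suc u v) ⟩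
      columnDet i (suc (u ℕ.+ v)) (suc v) + bottomDet i (suc (u ℕ.+ v)) v
        ≡⟨ bottomDet-suc i (u ℕ.+ v) v ⟨
      bottomDet i (suc (u ℕ.+ v)) (suc v)
        ≡⟨ cong (λ s → bottomDet i s (suc v)) (ℕ.+-suc u v) ⟨
      bottomDet i (u ℕ.+ suc v) (suc v)
        ∎
      where open ≡-Reasoning

  fromBottom-0-det : ∀ i v →
    fromBottom (suc i) 0 v ℕ.+ pascal₋ v (suc (suc i)) ℕ.* pascal (suc v) i
      ≡ pascal v (suc i) ℕ.* pascal v (suc i)
  fromBottom-0-det i v = ℤ.+-injective (begin
    + fromBottom (suc i) 0 v + + (c ℕ.* b)    ≡⟨ cong₂ _+_ (fromBottom-det i 0 v) (ℤ.pos-* c b) ⟩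
    (+ a * + a - + c * + b) + + c * + b       ≡⟨ cancel (+ a * + a) (+ c * + b) ⟩
    + a * + a                                 ≡⟨ ℤ.pos-* a a ⟨
    + (a ℕ.* a)                               ∎)
    where
    open ≡-Reasoning
    a = pascal v (suc i)
    b = pascal (suc v) i
    c = pascal₋ v (suc (suc i))
    cancel : ∀ x y → (x - y) + y ≡ x
    cancel = solve-∀

open import Algebra.Bundles using (CommutativeMonoid)
import Algebra.Properties.CommutativeSemigroup as CommutativeSemigroupProperties
open import Data.Bool using (Bool; true; false; _∧_)
open import Data.Bool.Properties using (T?; ∧-commutativeMonoid; ∧-assoc; ∧-identityʳ)
open import Data.List using (List; []; _∷_; _++_; map; concatMap; filter; length; upTo; applyUpTo)
open import Data.Nat
  using (ℕ; zero; suc; _+_; _*_; _∸_; _^_; _≤_; _<_; _≤ᵇ_; _≡ᵇ_; _≤?_; z≤n; s≤s; s≤s⁻¹)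
open import Data.Nat.Combinatorics using (_C_)
open import Data.Nat.Properties
open import Data.Nat.Tactic.RingSolver using (solve-∀)
open import Relation.Binary.PropositionalEquality
open import Relation.Nullary.Decidable using (dec-true; dec-false)

open Pascal
open Completions
open Determinants using (fromBottom-0-det)

-- fromBottom k 0 v counts the parallelogram polyominoes of width k + 1 and height v + 1.
narayana : ∀ k v → fromBottom k 0 v * (suc k * (v + suc k)) ≡ suc v * ((v + suc k) C k) ^ 2
narayana zero    v rewrite fromBottom-zero 0 v | +-comm v 1 = simplify v
  where
  simplify : ∀ v → 1 * (1 * suc v) ≡ suc v * (1 * (1 * 1))
  simplify = solve-∀
narayana (suc i) v = *-cancelˡ-≡ _ _ (suc v) (begin
  suc v * (P * (suc (suc i) * N))   ≡⟨ shuffle₁ P i v N ⟩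
  P * suc (suc i) * suc v * N       ≡⟨ cong (_* N) scaled ⟩
  a * a * N * N                     ≡⟨ shuffle₂ a N ⟩
  (a * N) ^ 2                       ≡⟨ cong (_^ 2) binomial-absorb ⟨
  (D * suc v) ^ 2                   ≡⟨ shuffle₃ D v ⟩
  suc v * (suc v * D ^ 2)           ∎)
  where
  open ≡-Reasoning
  P = fromBottom (suc i) 0 v
  a = pascal v (suc i)
  b = pascal (suc v) i
  c = pascal₋ v (suc (suc i))
  N = v + suc (suc i)
  D = N C suc i

  N≡ : suc (suc i + v) ≡ N
  N≡ = +-comm (suc (suc i)) v

  binomial-absorb : D * suc v ≡ a * N
  binomial-absorb = begin
    D * suc v                           ≡⟨ cong (λ n → (n C suc i) * suc v) (trans (sym N≡) (sym (+-suc (suc i) v))) ⟩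
    ((suc i + suc v) C suc i) * suc v   ≡⟨ cong (_* suc v) (C≡pascal (suc i) (suc v)) ⟩
    pascal (suc i) (suc v) * suc v      ≡⟨ pascal-absorb (suc i) v ⟩
    suc (suc i + v) * pascal (suc i) v  ≡⟨ cong₂ _*_ N≡ (pascal-sym (suc i) v) ⟩
    N * a                               ≡⟨ *-comm N a ⟩
    a * N                               ∎

  -- Multiplying the determinant relation P + c b = a² by (i + 2)(v + 1) and using
  -- c (i + 2) = a v and b (v + 1) = a (i + 1) leaves P (i + 2)(v + 1) = a² N.
  scaled : P * suc (suc i) * suc v ≡ a * a * N
  scaled = +-cancelʳ-≡ _ _ _ (begin
    P * suc (suc i) * suc v + (a * v) * (a * suc i)
      ≡⟨ cong₂ (λ x y → P * suc (suc i) * suc v + x * y) (pascal₋-swap v (suc i)) (sym (pascal-swap v i)) ⟨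
    P * suc (suc i) * suc v + (c * suc (suc i)) * (b * suc v)
      ≡⟨ factor P c b i v ⟨
    (P + c * b) * suc (suc i) * suc v
      ≡⟨ cong (λ z → z * suc (suc i) * suc v) (fromBottom-0-det i v) ⟩
    a * a * suc (suc i) * suc v
      ≡⟨ split a i v ⟩
    a * a * N + (a * v) * (a * suc i)
      ∎)
    where
    factor : ∀ p c b i v → (p + c * b) * suc (suc i) * suc v
           ≡ p * suc (suc i) * suc v + (c * suc (suc i)) * (b * suc v)
    factor = solve-∀
    split : ∀ a i v → a * a * suc (suc i) * suc v ≡ a * a * (v + suc (suc i)) + (a * v) * (a * suc i)
    split = solve-∀

  shuffle₁ : ∀ p i v n → suc v * (p * (suc (suc i) * n)) ≡ p * suc (suc i) * suc v * n
  shuffle₁ = solve-∀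
  shuffle₂ : ∀ a n → a * a * n * n ≡ (a * n) * ((a * n) * 1)
  shuffle₂ = solve-∀
  shuffle₃ : ∀ d v → (d * suc v) * ((d * suc v) * 1) ≡ suc v * (suc v * (d * (d * 1)))
  shuffle₃ = solve-∀

𝟙 : Bool → ℕ
𝟙 true  = 1
𝟙 false = 0

𝟙-∧ : ∀ x y → 𝟙 (x ∧ y) ≡ 𝟙 x * 𝟙 y
𝟙-∧ true  y = sym (+-identityʳ (𝟙 y))
𝟙-∧ false y = refl

𝟙-true-* : ∀ {b} x → b ≡ true → 𝟙 b * x ≡ x
𝟙-true-* x refl = +-identityʳ x

𝟙-false-* : ∀ {b} x → b ≡ false → 𝟙 b * x ≡ 0
𝟙-false-* x refl = refl

≤ᵇ-true : ∀ {m n} → m ≤ n → (m ≤ᵇ n) ≡ true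
≤ᵇ-true {m} {n} m≤n = dec-true (m ≤? n) m≤n

≤ᵇ-false : ∀ {m n} → n < m → (m ≤ᵇ n) ≡ false
≤ᵇ-false {m} {n} n<m = dec-false (m ≤? n) (<⇒≱ n<m)

≤ᵇ-cancelˡ-+ : ∀ a m n → (a + m ≤ᵇ a + n) ≡ (m ≤ᵇ n)
≤ᵇ-cancelˡ-+ zero    m n = refl
≤ᵇ-cancelˡ-+ (suc a) m n = trans (suc≤ᵇsuc (a + m) (a + n)) (≤ᵇ-cancelˡ-+ a m n)
  where
  suc≤ᵇsuc : ∀ m n → (suc m ≤ᵇ suc n) ≡ (m ≤ᵇ n)
  suc≤ᵇsuc zero    n = refl
  suc≤ᵇsuc (suc m) n = refl

≡ᵇ-cancelˡ-+ : ∀ a n → (a ≡ᵇ a + n) ≡ (0 ≡ᵇ n)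
≡ᵇ-cancelˡ-+ zero    n = refl
≡ᵇ-cancelˡ-+ (suc a) n = ≡ᵇ-cancelˡ-+ a n

∑ₗ : {A : Set} → (A → ℕ) → List A → ℕ
∑ₗ h []       = 0
∑ₗ h (x ∷ xs) = h x + ∑ₗ h xs

length-filter : {A : Set} (p : A → Bool) (xs : List A) →
  length (filter (λ x → T? (p x)) xs) ≡ ∑ₗ (λ x → 𝟙 (p x)) xs
length-filter p []       = refl
length-filter p (x ∷ xs) with p x
... | true  = cong suc (length-filter p xs)
... | false = length-filter p xs

∑ₗ-cong : {A : Set} {h k : A → ℕ} → (∀ x → h x ≡ k x) → ∀ xs → ∑ₗ h xs ≡ ∑ₗ k xs
∑ₗ-cong h≗k []       = refl
∑ₗ-cong h≗k (x ∷ xs) = cong₂ _+_ (h≗k x) (∑ₗ-cong h≗k xs)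

∑ₗ-*ˡ : {A : Set} (c : ℕ) (h : A → ℕ) (xs : List A) → ∑ₗ (λ x → c * h x) xs ≡ c * ∑ₗ h xs
∑ₗ-*ˡ c h []       = sym (*-zeroʳ c)
∑ₗ-*ˡ c h (x ∷ xs) = trans (cong (c * h x +_) (∑ₗ-*ˡ c h xs)) (sym (*-distribˡ-+ c (h x) _))

∑ₗ-++ : {A : Set} (h : A → ℕ) (xs ys : List A) → ∑ₗ h (xs ++ ys) ≡ ∑ₗ h xs + ∑ₗ h ys
∑ₗ-++ h []       ys = refl
∑ₗ-++ h (x ∷ xs) ys = trans (cong (h x +_) (∑ₗ-++ h xs ys)) (sym (+-assoc (h x) _ _))

∑ₗ-map : {A B : Set} (h : B → ℕ) (f : A → B) (xs : List A) → ∑ₗ h (map f xs) ≡ ∑ₗ (λ x → h (f x)) xs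
∑ₗ-map h f []       = refl
∑ₗ-map h f (x ∷ xs) = cong (h (f x) +_) (∑ₗ-map h f xs)

∑ₗ-concatMap : {A B : Set} (h : B → ℕ) (f : A → List B) (xs : List A) →
  ∑ₗ h (concatMap f xs) ≡ ∑ₗ (λ x → ∑ₗ h (f x)) xs
∑ₗ-concatMap h f []       = refl
∑ₗ-concatMap h f (x ∷ xs) =
  trans (∑ₗ-++ h (f x) (concatMap f xs)) (cong (∑ₗ h (f x) +_) (∑ₗ-concatMap h f xs))

∑< : ℕ → (ℕ → ℕ) → ℕ
∑< zero    h = 0
∑< (suc n) h = h 0 + ∑< n (λ i → h (suc i))

infixr 6 ∑<
syntax ∑< n (λ i → e) = ∑[ i < n ] e

∑ₗ-applyUpTo : {A : Set} (h : A → ℕ) (f : ℕ → A) (n : ℕ) → ∑ₗ h (applyUpTo f n) ≡ ∑[ i < n ] h (f i)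
∑ₗ-applyUpTo h f zero    = refl
∑ₗ-applyUpTo h f (suc n) = cong (h (f 0) +_) (∑ₗ-applyUpTo h (λ i → f (suc i)) n)

∑ₗ-upTo : (h : ℕ → ℕ) (n : ℕ) → ∑ₗ h (upTo n) ≡ ∑< n h
∑ₗ-upTo h = ∑ₗ-applyUpTo h (λ i → i)

∑-cong : ∀ n {h k : ℕ → ℕ} → (∀ i → h i ≡ k i) → ∑< n h ≡ ∑< n k
∑-cong zero    h≗k = refl
∑-cong (suc n) h≗k = cong₂ _+_ (h≗k 0) (∑-cong n (λ i → h≗k (suc i)))

∑-cong< : ∀ n {h k : ℕ → ℕ} → (∀ i → i < n → h i ≡ k i) → ∑< n h ≡ ∑< n k
∑-cong< zero    h≗k = refl
∑-cong< (suc n) h≗k = cong₂ _+_ (h≗k 0 (s≤s z≤n)) (∑-cong< n (λ i i<n → h≗k (suc i) (s≤s i<n)))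

∑-zero : ∀ n → ∑[ i < n ] 0 ≡ 0
∑-zero zero    = refl
∑-zero (suc n) = ∑-zero n

∑-*ˡ : ∀ n c (h : ℕ → ℕ) → ∑[ i < n ] c * h i ≡ c * ∑< n h
∑-*ˡ zero    c h = sym (*-zeroʳ c)
∑-*ˡ (suc n) c h = trans (cong (c * h 0 +_) (∑-*ˡ n c (λ i → h (suc i)))) (sym (*-distribˡ-+ c (h 0) _))

∑-*ʳ : ∀ n c (h : ℕ → ℕ) → ∑[ i < n ] h i * c ≡ ∑< n h * c
∑-*ʳ zero    c h = refl
∑-*ʳ (suc n) c h = trans (cong (h 0 * c +_) (∑-*ʳ n c (λ i → h (suc i)))) (sym (*-distribʳ-+ c (h 0) _))

∑-+ : ∀ a n (h : ℕ → ℕ) → ∑< (a + n) h ≡ ∑< a h + (∑[ i < n ] h (a + i))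
∑-+ zero    n h = refl
∑-+ (suc a) n h = trans (cong (h 0 +_) (∑-+ a n (λ i → h (suc i)))) (sym (+-assoc (h 0) _ _))

∑-from : ∀ a n (h : ℕ → ℕ) → ∑[ x < a + n ] 𝟙 (a ≤ᵇ x) * h x ≡ ∑[ i < n ] h (a + i)
∑-from a n h = begin
  ∑[ x < a + n ] 𝟙 (a ≤ᵇ x) * h x
    ≡⟨ ∑-+ a n (λ x → 𝟙 (a ≤ᵇ x) * h x) ⟩
  (∑[ x < a ] 𝟙 (a ≤ᵇ x) * h x) + (∑[ i < n ] 𝟙 (a ≤ᵇ a + i) * h (a + i))
    ≡⟨ cong₂ _+_ (trans (∑-cong< a λ x x<a → 𝟙-false-* (h x) (≤ᵇ-false x<a)) (∑-zero a))
                 (∑-cong n λ i → 𝟙-true-* (h (a + i)) (≤ᵇ-true (m≤m+n a i))) ⟩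
  ∑[ i < n ] h (a + i)
    ∎
  where open ≡-Reasoning

∑-until : ∀ u n (h : ℕ → ℕ) → ∑[ x < suc u + n ] 𝟙 (x ≤ᵇ u) * h x ≡ ∑< (suc u) h
∑-until u n h = begin
  ∑[ x < suc u + n ] 𝟙 (x ≤ᵇ u) * h x
    ≡⟨ ∑-+ (suc u) n (λ x → 𝟙 (x ≤ᵇ u) * h x) ⟩
  (∑[ x < suc u ] 𝟙 (x ≤ᵇ u) * h x) + (∑[ i < n ] 𝟙 (suc u + i ≤ᵇ u) * h (suc u + i))
    ≡⟨ cong₂ _+_ (∑-cong< (suc u) λ x x≤u → 𝟙-true-* (h x) (≤ᵇ-true (s≤s⁻¹ x≤u)))
                 (trans (∑-cong n λ i → 𝟙-false-* (h (suc u + i)) (≤ᵇ-false (s≤s (m≤m+n u i)))) (∑-zero n)) ⟩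
  ∑< (suc u) h + 0
    ≡⟨ +-identityʳ _ ⟩
  ∑< (suc u) h
    ∎
  where open ≡-Reasoning

∑-window : ∀ a u n (h : ℕ → ℕ) →
  ∑[ x < a + (suc u + n) ] 𝟙 (a ≤ᵇ x) * (𝟙 (x ≤ᵇ a + u) * h x) ≡ ∑[ i < suc u ] h (a + i)
∑-window a u n h = begin
  ∑[ x < a + (suc u + n) ] 𝟙 (a ≤ᵇ x) * (𝟙 (x ≤ᵇ a + u) * h x)
    ≡⟨ ∑-from a (suc u + n) (λ x → 𝟙 (x ≤ᵇ a + u) * h x) ⟩
  ∑[ i < suc u + n ] 𝟙 (a + i ≤ᵇ a + u) * h (a + i)
    ≡⟨ ∑-cong (suc u + n) (λ i → cong (λ z → 𝟙 z * h (a + i)) (≤ᵇ-cancelˡ-+ a i u)) ⟩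
  ∑[ i < suc u + n ] 𝟙 (i ≤ᵇ u) * h (a + i)
    ≡⟨ ∑-until u n (λ i → h (a + i)) ⟩
  ∑[ i < suc u ] h (a + i)
    ∎
  where open ≡-Reasoning

fromColumn-sum : ∀ j u v → fromColumn (suc j) u v ≡ ∑[ i < suc u ] fromBottom j (u ∸ i) v
fromColumn-sum j zero    v = sym (+-identityʳ _)
fromColumn-sum j (suc u) v = cong (fromBottom j (suc u) v +_) (fromColumn-sum j u v)

fromBottom-sum : ∀ j c v → fromBottom j c v ≡ ∑[ d < suc v ] fromColumn j (c + d) (v ∸ d)
fromBottom-sum j c zero    = trans (cong (λ z → fromColumn j z 0) (sym (+-identityʳ c))) (sym (+-identityʳ _))
fromBottom-sum j c (suc v) = cong₂ _+_ (cong (λ z → fromColumn j z (suc v)) (sym (+-identityʳ c)))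
  (trans (fromBottom-sum j (suc c) v) (∑-cong (suc v) (λ d → cong (λ z → fromColumn j z (v ∸ d)) (sym (+-suc c d)))))

open CommutativeSemigroupProperties (CommutativeMonoid.commutativeSemigroup ∧-commutativeMonoid)
  using () renaming (interchange to ∧-interchange; x∙yz≈y∙xz to ∧-left-comm)
open CommutativeSemigroupProperties *-commutativeSemigroup
  using () renaming (interchange to *-interchange)

validFrom : ℕ → ℕ → Plateau → List Plateau → Bool
validFrom n m p []       = plateauOK p ∧ (((top p + 1) ≡ᵇ n) ∧ ((back p + 1) ≡ᵇ m))
validFrom n m p (q ∷ ps) = (plateauOK p ∧ stepOK p q) ∧ validFrom n m q ps

validFrom-spec : ∀ n m p ps →
  allPlateausOK (p ∷ ps) ∧ (chainOK (p ∷ ps) ∧ lastHasSize n m (p ∷ ps)) ≡ validFrom n m p ps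
validFrom-spec n m p [] = cong (_∧ lastHasSize n m (p ∷ [])) (∧-identityʳ (plateauOK p))
validFrom-spec n m p (q ∷ ps) = begin
  (plateauOK p ∧ A) ∧ ((stepOK p q ∧ Ch) ∧ L)   ≡⟨ cong ((plateauOK p ∧ A) ∧_) (∧-assoc (stepOK p q) Ch L) ⟩
  (plateauOK p ∧ A) ∧ (stepOK p q ∧ (Ch ∧ L))   ≡⟨ ∧-interchange (plateauOK p) A (stepOK p q) (Ch ∧ L) ⟩
  (plateauOK p ∧ stepOK p q) ∧ (A ∧ (Ch ∧ L))   ≡⟨ cong ((plateauOK p ∧ stepOK p q) ∧_) (validFrom-spec n m q ps) ⟩
  (plateauOK p ∧ stepOK p q) ∧ validFrom n m q ps ∎
  where
  open ≡-Reasoning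
  A = allPlateausOK (q ∷ ps)
  Ch = chainOK (q ∷ ps)
  L = lastHasSize n m (q ∷ ps)

isParallelogram-∷ : ∀ n m p ps →
  isParallelogram n m (p ∷ ps) ≡ ((bot p ≡ᵇ 0) ∧ (front p ≡ᵇ 0)) ∧ validFrom n m p ps
isParallelogram-∷ n m p ps = begin
  A ∧ (Ch ∧ (F ∧ L))   ≡⟨ cong (A ∧_) (∧-left-comm Ch F L) ⟩
  A ∧ (F ∧ (Ch ∧ L))   ≡⟨ ∧-left-comm A F (Ch ∧ L) ⟩
  F ∧ (A ∧ (Ch ∧ L))   ≡⟨ cong (F ∧_) (validFrom-spec n m p ps) ⟩
  F ∧ validFrom n m p ps ∎
  where
  open ≡-Reasoning
  A = allPlateausOK (p ∷ ps)
  Ch = chainOK (p ∷ ps)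
  F = firstNormalised (p ∷ ps)
  L = lastHasSize n m (p ∷ ps)

extensions : ℕ → ℕ → ℕ → Plateau → ℕ
extensions n m k p = ∑ₗ (λ ps → 𝟙 (validFrom n m p ps)) (listsOfLength k (candidatePlateaus n m))

-- chains N k b t counts the sequences of k further intervals of rows in [0, N) that
-- may follow the interval [b, t] in a parallelogram polyomino, the last one ending
-- at row N - 1; it is 0 unless b ≤ t.
chains : ℕ → ℕ → ℕ → ℕ → ℕ
chains N zero    b t = 𝟙 (b ≤ᵇ t) * 𝟙 ((t + 1) ≡ᵇ N)
chains N (suc k) b t = ∑[ b′ < N ] ∑[ t′ < N ]
  𝟙 (b ≤ᵇ t) * (𝟙 (b ≤ᵇ b′) * (𝟙 (b′ ≤ᵇ t) * (𝟙 (t ≤ᵇ t′) * chains N k b′ t′)))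

∑ₗ-listsOfLength : {A : Set} (h : List A → ℕ) (k : ℕ) (xs : List A) →
  ∑ₗ h (listsOfLength (suc k) xs) ≡ ∑ₗ (λ x → ∑ₗ (λ ps → h (x ∷ ps)) (listsOfLength k xs)) xs
∑ₗ-listsOfLength h k xs =
  trans (∑ₗ-concatMap h _ xs) (∑ₗ-cong (λ x → ∑ₗ-map h (x ∷_) (listsOfLength k xs)) xs)

∑ₗ-candidatePlateaus : ∀ n m (h : Plateau → ℕ) → ∑ₗ h (candidatePlateaus n m)
  ≡ ∑[ b < n ] ∑[ t < n ] ∑[ f < m ] ∑[ r < m ] h (plateau b t f r)
∑ₗ-candidatePlateaus n m h =
  trans (∑ₗ-concatMap h _ (upTo n)) (trans (∑ₗ-upTo _ n) (∑-cong n λ b →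
  trans (∑ₗ-concatMap h _ (upTo n)) (trans (∑ₗ-upTo _ n) (∑-cong n λ t →
  trans (∑ₗ-concatMap h _ (upTo m)) (trans (∑ₗ-upTo _ m) (∑-cong m λ f →
  trans (∑ₗ-map h _ (upTo m)) (∑ₗ-upTo _ m)))))))

∑²-*-∑² : ∀ n m (α β : ℕ → ℕ → ℕ) →
  ∑[ b < n ] ∑[ t < n ] ∑[ f < m ] ∑[ r < m ] α b t * β f r
    ≡ (∑[ b < n ] ∑[ t < n ] α b t) * (∑[ f < m ] ∑[ r < m ] β f r)
∑²-*-∑² n m α β =
  trans (∑-cong n λ b → trans (∑-cong n λ t →
           trans (∑-cong m λ f → ∑-*ˡ m (α b t) (β f)) (∑-*ˡ m (α b t) λ f → ∑< m (β f)))
         (∑-*ʳ n _ (α b)))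
        (∑-*ʳ n _ λ b → ∑< n (α b))

-- The step condition between two plateaus is the conjunction of the step
-- conditions of their (bottom, top) and (front, back) intervals.
𝟙-step : ∀ x₁ x₂ y₁ y₂ y₃ y₄ y₅ y₆ a c →
  𝟙 ((x₁ ∧ x₂) ∧ (y₁ ∧ y₂ ∧ y₃ ∧ y₄ ∧ y₅ ∧ y₆)) * (a * c)
    ≡ 𝟙 x₁ * (𝟙 y₁ * (𝟙 y₅ * (𝟙 y₂ * a))) * (𝟙 x₂ * (𝟙 y₃ * (𝟙 y₆ * (𝟙 y₄ * c))))
𝟙-step x₁ x₂ y₁ y₂ y₃ y₄ y₅ y₆ a c
  rewrite 𝟙-∧ (x₁ ∧ x₂) (y₁ ∧ y₂ ∧ y₃ ∧ y₄ ∧ y₅ ∧ y₆) | 𝟙-∧ x₁ x₂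
        | 𝟙-∧ y₁ (y₂ ∧ y₃ ∧ y₄ ∧ y₅ ∧ y₆) | 𝟙-∧ y₂ (y₃ ∧ y₄ ∧ y₅ ∧ y₆)
        | 𝟙-∧ y₃ (y₄ ∧ y₅ ∧ y₆) | 𝟙-∧ y₄ (y₅ ∧ y₆) | 𝟙-∧ y₅ y₆
  = regroup (𝟙 x₁) (𝟙 x₂) (𝟙 y₁) (𝟙 y₂) (𝟙 y₃) (𝟙 y₄) (𝟙 y₅) (𝟙 y₆) a c
  where
  regroup : ∀ x₁ x₂ y₁ y₂ y₃ y₄ y₅ y₆ a c →
    x₁ * x₂ * (y₁ * (y₂ * (y₃ * (y₄ * (y₅ * y₆))))) * (a * c)
      ≡ x₁ * (y₁ * (y₅ * (y₂ * a))) * (x₂ * (y₃ * (y₆ * (y₄ * c))))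
  regroup = solve-∀

extensions-factorise : ∀ n m k b t f r →
  extensions n m k (plateau b t f r) ≡ chains n k b t * chains m k f r
extensions-factorise n m zero b t f r = begin
  𝟙 ((b≤t ∧ f≤r) ∧ (top≡ ∧ back≡)) + 0        ≡⟨ +-identityʳ _ ⟩
  𝟙 ((b≤t ∧ f≤r) ∧ (top≡ ∧ back≡))            ≡⟨ cong 𝟙 (∧-interchange b≤t f≤r top≡ back≡) ⟩
  𝟙 ((b≤t ∧ top≡) ∧ (f≤r ∧ back≡))            ≡⟨ 𝟙-∧ (b≤t ∧ top≡) (f≤r ∧ back≡) ⟩
  𝟙 (b≤t ∧ top≡) * 𝟙 (f≤r ∧ back≡)            ≡⟨ cong₂ _*_ (𝟙-∧ b≤t top≡) (𝟙-∧ f≤r back≡) ⟩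
  𝟙 b≤t * 𝟙 top≡ * (𝟙 f≤r * 𝟙 back≡)          ∎
  where
  open ≡-Reasoning
  b≤t = b ≤ᵇ t
  f≤r = f ≤ᵇ r
  top≡ = (t + 1) ≡ᵇ n
  back≡ = (r + 1) ≡ᵇ m
extensions-factorise n m (suc k) b t f r = begin
  extensions n m (suc k) p
    ≡⟨ ∑ₗ-listsOfLength (λ ps → 𝟙 (validFrom n m p ps)) k (candidatePlateaus n m) ⟩
  ∑ₗ (λ q → ∑ₗ (λ ps → 𝟙 ((plateauOK p ∧ stepOK p q) ∧ validFrom n m q ps)) lists) (candidatePlateaus n m)
    ≡⟨ ∑ₗ-cong (λ q → trans (∑ₗ-cong (λ ps → 𝟙-∧ (plateauOK p ∧ stepOK p q) (validFrom n m q ps)) lists)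
                            (∑ₗ-*ˡ (𝟙 (plateauOK p ∧ stepOK p q)) (λ ps → 𝟙 (validFrom n m q ps)) lists))
               (candidatePlateaus n m) ⟩
  ∑ₗ (λ q → 𝟙 (plateauOK p ∧ stepOK p q) * extensions n m k q) (candidatePlateaus n m)
    ≡⟨ ∑ₗ-candidatePlateaus n m _ ⟩
  (∑[ b′ < n ] ∑[ t′ < n ] ∑[ f′ < m ] ∑[ r′ < m ]
     𝟙 (plateauOK p ∧ stepOK p (plateau b′ t′ f′ r′)) * extensions n m k (plateau b′ t′ f′ r′))
    ≡⟨ (∑-cong n λ b′ → ∑-cong n λ t′ → ∑-cong m λ f′ → ∑-cong m λ r′ →
         trans (cong (𝟙 (plateauOK p ∧ stepOK p (plateau b′ t′ f′ r′)) *_)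
                     (extensions-factorise n m k b′ t′ f′ r′))
               (𝟙-step (b ≤ᵇ t) (f ≤ᵇ r) (b ≤ᵇ b′) (t ≤ᵇ t′) (f ≤ᵇ f′) (r ≤ᵇ r′) (b′ ≤ᵇ t) (f′ ≤ᵇ r) _ _)) ⟩
  (∑[ b′ < n ] ∑[ t′ < n ] ∑[ f′ < m ] ∑[ r′ < m ]
     𝟙 (b ≤ᵇ t) * (𝟙 (b ≤ᵇ b′) * (𝟙 (b′ ≤ᵇ t) * (𝟙 (t ≤ᵇ t′) * chains n k b′ t′)))
   * (𝟙 (f ≤ᵇ r) * (𝟙 (f ≤ᵇ f′) * (𝟙 (f′ ≤ᵇ r) * (𝟙 (r ≤ᵇ r′) * chains m k f′ r′)))))
    ≡⟨ ∑²-*-∑² n m _ _ ⟩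
  chains n (suc k) b t * chains m (suc k) f r
    ∎
  where
  open ≡-Reasoning
  p = plateau b t f r
  lists = listsOfLength k (candidatePlateaus n m)

∑-first : ∀ n N (h : ℕ → ℕ → ℕ) → ∑[ b < suc n ] ∑[ t < N ] 𝟙 (b ≡ᵇ 0) * h b t ≡ ∑[ t < N ] h 0 t
∑-first n N h =
  trans (cong₂ _+_ (∑-cong N λ t → *-identityˡ (h 0 t)) (trans (∑-cong n λ _ → ∑-zero N) (∑-zero n)))
        (+-identityʳ _)

s-factorise : ∀ k n m →
  s (suc k) (suc n) (suc m) ≡ (∑[ t < suc n ] chains (suc n) k 0 t) * (∑[ r < suc m ] chains (suc m) k 0 r)
s-factorise k n m = begin
  s (suc k) N M
    ≡⟨ length-filter (isParallelogram N M) (listsOfLength (suc k) cands) ⟩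
  ∑ₗ (λ ps → 𝟙 (isParallelogram N M ps)) (listsOfLength (suc k) cands)
    ≡⟨ ∑ₗ-listsOfLength (λ ps → 𝟙 (isParallelogram N M ps)) k cands ⟩
  ∑ₗ (λ p → ∑ₗ (λ ps → 𝟙 (isParallelogram N M (p ∷ ps))) lists) cands
    ≡⟨ ∑ₗ-cong (λ p → trans (∑ₗ-cong (λ ps → trans (cong 𝟙 (isParallelogram-∷ N M p ps))
                                                   (𝟙-∧ (first p) (validFrom N M p ps))) lists)
                            (∑ₗ-*ˡ (𝟙 (first p)) (λ ps → 𝟙 (validFrom N M p ps)) lists)) cands ⟩
  ∑ₗ (λ p → 𝟙 (first p) * extensions N M k p) cands
    ≡⟨ ∑ₗ-candidatePlateaus N M _ ⟩
  (∑[ b < N ] ∑[ t < N ] ∑[ f < M ] ∑[ r < M ]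
     𝟙 ((b ≡ᵇ 0) ∧ (f ≡ᵇ 0)) * extensions N M k (plateau b t f r))
    ≡⟨ (∑-cong N λ b → ∑-cong N λ t → ∑-cong M λ f → ∑-cong M λ r →
         trans (cong₂ _*_ (𝟙-∧ (b ≡ᵇ 0) (f ≡ᵇ 0)) (extensions-factorise N M k b t f r))
               (*-interchange (𝟙 (b ≡ᵇ 0)) (𝟙 (f ≡ᵇ 0)) (chains N k b t) (chains M k f r))) ⟩
  (∑[ b < N ] ∑[ t < N ] ∑[ f < M ] ∑[ r < M ] 𝟙 (b ≡ᵇ 0) * chains N k b t * (𝟙 (f ≡ᵇ 0) * chains M k f r))
    ≡⟨ ∑²-*-∑² N M (λ b t → 𝟙 (b ≡ᵇ 0) * chains N k b t) (λ f r → 𝟙 (f ≡ᵇ 0) * chains M k f r) ⟩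
  (∑[ b < N ] ∑[ t < N ] 𝟙 (b ≡ᵇ 0) * chains N k b t) * (∑[ f < M ] ∑[ r < M ] 𝟙 (f ≡ᵇ 0) * chains M k f r)
    ≡⟨ cong₂ _*_ (∑-first n N (chains N k)) (∑-first m M (chains M k)) ⟩
  (∑[ t < N ] chains N k 0 t) * (∑[ r < M ] chains M k 0 r)
    ∎
  where
  open ≡-Reasoning
  N = suc n
  M = suc m
  cands = candidatePlateaus N M
  lists = listsOfLength k cands
  first : Plateau → Bool
  first p = (bot p ≡ᵇ 0) ∧ (front p ≡ᵇ 0)

chains-suc : ∀ k b u v →
  chains (suc (b + u + v)) (suc k) b (b + u)
    ≡ ∑[ i < suc u ] ∑[ d < suc v ] chains (suc (b + u + v)) k (b + i) (b + u + d)
chains-suc k b u v = begin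
  (∑[ b′ < N ] ∑[ t′ < N ] 𝟙 (b ≤ᵇ b + u) * step b′ t′)
    ≡⟨ (∑-cong N λ b′ → ∑-cong N λ t′ →
         𝟙-true-* (step b′ t′) (≤ᵇ-true (m≤m+n b u))) ⟩
  (∑[ b′ < N ] ∑[ t′ < N ] 𝟙 (b ≤ᵇ b′) * (𝟙 (b′ ≤ᵇ b + u) * (𝟙 (b + u ≤ᵇ t′) * X b′ t′)))
    ≡⟨ (∑-cong N λ b′ → trans (∑-*ˡ N (𝟙 (b ≤ᵇ b′)) λ t′ → 𝟙 (b′ ≤ᵇ b + u) * above b′ t′)
                               (cong (𝟙 (b ≤ᵇ b′) *_) (∑-*ˡ N (𝟙 (b′ ≤ᵇ b + u)) (above b′)))) ⟩
  (∑[ b′ < N ] 𝟙 (b ≤ᵇ b′) * (𝟙 (b′ ≤ᵇ b + u) * (∑[ t′ < N ] 𝟙 (b + u ≤ᵇ t′) * X b′ t′)))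
    ≡⟨ (∑-cong N λ b′ → cong (λ z → 𝟙 (b ≤ᵇ b′) * (𝟙 (b′ ≤ᵇ b + u) * z))
         (trans (cong (λ n → ∑< n (above b′)) N≡top) (∑-from (b + u) (suc v) (X b′)))) ⟩
  (∑[ b′ < N ] 𝟙 (b ≤ᵇ b′) * (𝟙 (b′ ≤ᵇ b + u) * (∑[ d < suc v ] X b′ (b + u + d))))
    ≡⟨ cong (λ n → ∑[ b′ < n ] 𝟙 (b ≤ᵇ b′) * (𝟙 (b′ ≤ᵇ b + u) * window b′)) N≡bottom ⟩
  (∑[ b′ < b + (suc u + v) ] 𝟙 (b ≤ᵇ b′) * (𝟙 (b′ ≤ᵇ b + u) * (∑[ d < suc v ] X b′ (b + u + d))))
    ≡⟨ ∑-window b u v window ⟩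
  (∑[ i < suc u ] ∑[ d < suc v ] X (b + i) (b + u + d))
    ∎
  where
  open ≡-Reasoning
  N = suc (b + u + v)
  X = chains N k
  above : ℕ → ℕ → ℕ
  above b′ t′ = 𝟙 (b + u ≤ᵇ t′) * X b′ t′
  window : ℕ → ℕ
  window b′ = ∑[ d < suc v ] X b′ (b + u + d)
  step : ℕ → ℕ → ℕ
  step b′ t′ = 𝟙 (b ≤ᵇ b′) * (𝟙 (b′ ≤ᵇ b + u) * above b′ t′)
  N≡top : N ≡ b + u + suc v
  N≡top = sym (+-suc (b + u) v)
  N≡bottom : N ≡ b + (suc u + v)
  N≡bottom = trans (cong suc (+-assoc b u v)) (sym (+-suc b (u + v)))

chains≡fromColumn : ∀ k b u v → chains (suc (b + u + v)) k b (b + u) ≡ fromColumn k u v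
chains≡fromColumn zero b u v
  rewrite ≤ᵇ-true (m≤m+n b u) | +-comm (b + u) 1 | ≡ᵇ-cancelˡ-+ (b + u) v with v
... | zero  = refl
... | suc _ = refl
chains≡fromColumn (suc k) b u v = begin
  chains N (suc k) b (b + u)
    ≡⟨ chains-suc k b u v ⟩
  (∑[ i < suc u ] ∑[ d < suc v ] chains N k (b + i) (b + u + d))
    ≡⟨ (∑-cong< (suc u) λ i i≤u → ∑-cong< (suc v) λ d d≤v → shifted i d (s≤s⁻¹ i≤u) (s≤s⁻¹ d≤v)) ⟩
  (∑[ i < suc u ] ∑[ d < suc v ] fromColumn k (u ∸ i + d) (v ∸ d))
    ≡⟨ (∑-cong (suc u) λ i → fromBottom-sum k (u ∸ i) v) ⟨
  (∑[ i < suc u ] fromBottom k (u ∸ i) v)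
    ≡⟨ fromColumn-sum k u v ⟨
  fromColumn (suc k) u v
    ∎
  where
  open ≡-Reasoning
  N = suc (b + u + v)
  shifted : ∀ i d → i ≤ u → d ≤ v → chains N k (b + i) (b + u + d) ≡ fromColumn k (u ∸ i + d) (v ∸ d)
  shifted i d i≤u d≤v = begin
    chains N k (b + i) (b + u + d)
      ≡⟨ cong₂ (λ n t → chains n k (b + i) t) N≡ t≡ ⟩
    chains (suc (b + i + (u ∸ i + d) + (v ∸ d))) k (b + i) (b + i + (u ∸ i + d))
      ≡⟨ chains≡fromColumn k (b + i) (u ∸ i + d) (v ∸ d) ⟩
    fromColumn k (u ∸ i + d) (v ∸ d)
      ∎
    where
    rearrange : ∀ b i x d → b + (i + x) + d ≡ b + i + (x + d)
    rearrange = solve-∀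
    t≡ : b + u + d ≡ b + i + (u ∸ i + d)
    t≡ = trans (cong (λ z → b + z + d) (sym (m+[n∸m]≡n i≤u))) (rearrange b i (u ∸ i) d)
    N≡ : N ≡ suc (b + i + (u ∸ i + d) + (v ∸ d))
    N≡ = cong suc (begin
      b + u + v                            ≡⟨ cong (b + u +_) (m+[n∸m]≡n d≤v) ⟨
      b + u + (d + (v ∸ d))                ≡⟨ +-assoc (b + u) d (v ∸ d) ⟨
      b + u + d + (v ∸ d)                  ≡⟨ cong (_+ (v ∸ d)) t≡ ⟩
      b + i + (u ∸ i + d) + (v ∸ d)        ∎)

∑chains≡fromBottom : ∀ k v → ∑[ t < suc v ] chains (suc v) k 0 t ≡ fromBottom k 0 v
∑chains≡fromBottom k v =
  trans (∑-cong< (suc v) λ t t≤v →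
           trans (cong (λ n → chains (suc n) k 0 t) (sym (m+[n∸m]≡n (s≤s⁻¹ t≤v))))
                 (chains≡fromColumn k 0 t (v ∸ t)))
        (sym (fromBottom-sum k 0 v))

s≡fromBottom*fromBottom : ∀ k v w → s (suc k) (suc v) (suc w) ≡ fromBottom k 0 v * fromBottom k 0 w
s≡fromBottom*fromBottom k v w =
  trans (s-factorise k v w) (cong₂ _*_ (∑chains≡fromBottom k v) (∑chains≡fromBottom k w))

theorem3 : (k n m : ℕ) → 1 ≤ k → 1 ≤ n → 1 ≤ m →
    s k n m * (k ^ 2 * (n + k ∸ 1) * (m + k ∸ 1))
    ≡ n * m * ((n + k ∸ 1) C (k ∸ 1)) ^ 2 * ((m + k ∸ 1) C (k ∸ 1)) ^ 2
theorem3 (suc k) (suc v) (suc w) (s≤s z≤n) (s≤s z≤n) (s≤s z≤n) = begin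
  s (suc k) (suc v) (suc w) * (suc k ^ 2 * (v + suc k) * (w + suc k))
    ≡⟨ cong (_* (suc k ^ 2 * (v + suc k) * (w + suc k))) (s≡fromBottom*fromBottom k v w) ⟩
  fromBottom k 0 v * fromBottom k 0 w * (suc k ^ 2 * (v + suc k) * (w + suc k))
    ≡⟨ regroup (fromBottom k 0 v) (fromBottom k 0 w) (suc k) (v + suc k) (w + suc k) ⟩
  fromBottom k 0 v * (suc k * (v + suc k)) * (fromBottom k 0 w * (suc k * (w + suc k)))
    ≡⟨ cong₂ _*_ (narayana k v) (narayana k w) ⟩
  suc v * ((v + suc k) C k) ^ 2 * (suc w * ((w + suc k) C k) ^ 2)
    ≡⟨ *-interchange (suc v) (((v + suc k) C k) ^ 2) (suc w) (((w + suc k) C k) ^ 2) ⟩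
  suc v * suc w * (((v + suc k) C k) ^ 2 * ((w + suc k) C k) ^ 2)
    ≡⟨ *-assoc (suc v * suc w) (((v + suc k) C k) ^ 2) (((w + suc k) C k) ^ 2) ⟨
  suc v * suc w * ((v + suc k) C k) ^ 2 * ((w + suc k) C k) ^ 2
    ∎
  where
  open ≡-Reasoning
  regroup : ∀ p q k x y → p * q * (k * (k * 1) * x * y) ≡ p * (k * x) * (q * (k * y))
  regroup = solve-∀
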